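{- Let $t \ge 1$ and $m \ge 0$ be integers, and let $T$ be a strongly connected $t$-arc-bounded tournament containing two vertices $u$ and $v$ such that $\vec\chi(T[N^+(u)]) \le m$ and $\vec\chi(T[N^-(v)]) \le m$. Then $\vec\chi(T) \le 2m + 5t$.
   Context: For a vertex $v$, $N^+(v)$, $N^-(v)$ are the out- and in-neighbourhoods; for an arc $e = uv$, $N(e) = N^+(v)\cap N^-(u)$. $\vec\chi$ of a tournament is the minimum number of acyclic induced subtournaments partitioning its vertex set. $T$ is $t$-arc-bounded if $\vec\chi(T[N(e)]) \le t$ for every arc $e$. -}

module Defs where

open import Data.Nat using (ℕ)
open import Data.Fin using (Fin)
open import Data.Sum using (_⊎_)
open import Data.Unit using (⊤)
open import Data.Product using (Σ; _×_)
open import Relation.Nullary using (¬_)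
open import Relation.Unary using (Pred; _∩_)
open import Relation.Binary.PropositionalEquality using (_≡_; _≢_)

record Tournament (n : ℕ) : Set₁ where
  field
    arc     : Fin n → Fin n → Set
    irrefl  : ∀ x → ¬ arc x x
    asym    : ∀ x y → arc x y → ¬ arc y x
    total   : ∀ x y → x ≢ y → arc x y ⊎ arc y x

module _ {n : ℕ} (T : Tournament n) where
  open Tournament T

  N⁺ : Fin n → Pred (Fin n) _
  N⁺ v w = arc v w

  N⁻ : Fin n → Pred (Fin n) _
  N⁻ v w = arc w v

  Narc : Fin n → Fin n → Pred (Fin n) _
  Narc u v = N⁺ v ∩ N⁻ u

  data Walk (S : Pred (Fin n) _) : Fin n → Fin n → Set where
    step : ∀ {x y}   → S x → S y → arc x y → Walk S x y
    cons : ∀ {x y z} → S x → arc x y → Walk S y z → Walk S x z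

  Acyclic : Pred (Fin n) _ → Set
  Acyclic S = ∀ x → ¬ Walk S x x

  -- χ⃗(T[S]) ≤ k: the vertex set S can be partitioned into k sets (colour
  -- classes, possibly empty) each inducing an acyclic subtournament.
  DichrLe : Pred (Fin n) _ → ℕ → Set
  DichrLe S k = Σ (Fin n → Fin k) λ c → ∀ (i : Fin k) → Acyclic (λ x → S x × c x ≡ i)

  Whole : Pred (Fin n) _
  Whole _ = ⊤

  StronglyConnected : Set
  StronglyConnected = ∀ x y → x ≢ y → Walk Whole x y

  ArcBounded : ℕ → Set
  ArcBounded t = ∀ u v → arc u v → DichrLe (Narc u v) t

-- Let d be the distance from u and u = p₀ → p₁ → ⋯ → pₖ = v a shortest path.
-- N⁺(u) and N⁻(v) take 2m colours. Every other vertex w ≠ v lies in the band of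
-- vertices dominated by pₖ but not by p₀, so for some j < k (its key) we have
-- p_{j+1} → w → p_j, i.e. w ∈ N(p_j p_{j+1}). Along an arc a → b of the band,
-- key b ≤ d b + 1 ≤ d a + 2 ≤ key a + 4; colouring w by key w mod 5 and by its
-- colour in a t-colouring of N(p_j p_{j+1}) therefore makes the key non-increasing
-- in each colour class, so a monochromatic cycle has constant key and lies in a
-- single acyclic class of one arc neighbourhood. The vertex v has no in-neighbour
-- among the uncoloured vertices, so it lies on no cycle there.

module Submission where

open import Defs
open import Data.Nat using (ℕ; zero; suc; pred; _≤_; _<_; _+_; _*_; _∸_; z≤n; s≤s; z<s; s≤s⁻¹; NonZero)
open import Data.Nat.Properties
  using (≤-refl; ≤-trans; ≤-antisym; _≤?_; _<?_; <⇒≱; ≰⇒>; n<1+n; m<n⇒m<1+n; <⇒≤;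
         +-assoc; +-comm; +-identityʳ; +-monoʳ-≤; *-monoˡ-≤; n∸n≡0; m∸[m∸n]≡n;
         pred[m∸n]≡m∸[1+n]; +-∸-assoc; module ≤-Reasoning)
open import Data.Nat.DivMod using (_%_; _/_; _mod_; m≡m%n+[m/n]*n)
open import Data.Fin using (Fin; _≟_; toℕ; fromℕ<; join; splitAt; combine)
open import Data.Fin.Properties using (any?; splitAt-join; combine-injective; toℕ-fromℕ<)
open import Data.Product using (Σ; ∃; _×_; _,_; proj₁; proj₂; uncurry)
open import Data.Sum using (_⊎_; inj₁; inj₂)
open import Function using (_∘_)
open import Function.Definitions using (Injective)
open import Level using (0ℓ)
open import Relation.Nullary using (¬_; Dec; yes; no; contradiction)
open import Relation.Nullary.Decidable using (_⊎-dec_; _×-dec_)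
open import Relation.Unary using (Pred; Decidable; _⊆_; _∩_; ∁)
open import Relation.Binary.PropositionalEquality
  using (_≡_; _≢_; refl; sym; trans; cong; cong₂; subst; module ≡-Reasoning)

%-window : ∀ n .{{_ : NonZero n}} {a b} → b % n ≡ a % n → b < n + a → b ≤ a
%-window n {a} {b} b≡a b<n+a with b / n ≤? a / n
... | yes b/n≤a/n = begin
  b                   ≡⟨ m≡m%n+[m/n]*n b n ⟩
  b % n + b / n * n   ≤⟨ +-monoʳ-≤ (b % n) (*-monoˡ-≤ n b/n≤a/n) ⟩
  b % n + a / n * n   ≡⟨ cong (_+ a / n * n) b≡a ⟩
  a % n + a / n * n   ≡⟨ sym (m≡m%n+[m/n]*n a n) ⟩
  a                   ∎
  where open ≤-Reasoning
... | no b/n≰a/n = contradiction n+a≤b (<⇒≱ b<n+a)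
  where
  open ≤-Reasoning
  n+a≤b : n + a ≤ b
  n+a≤b = begin
    n + a                          ≡⟨ cong (n +_) (m≡m%n+[m/n]*n a n) ⟩
    n + (a % n + a / n * n)        ≡⟨ sym (+-assoc n (a % n) _) ⟩
    n + a % n + a / n * n          ≡⟨ cong (_+ a / n * n) (+-comm n (a % n)) ⟩
    a % n + n + a / n * n          ≡⟨ +-assoc (a % n) n _ ⟩
    a % n + suc (a / n) * n        ≡⟨ cong (_+ suc (a / n) * n) (sym b≡a) ⟩
    b % n + suc (a / n) * n        ≤⟨ +-monoʳ-≤ (b % n) (*-monoˡ-≤ n (≰⇒> b/n≰a/n)) ⟩
    b % n + b / n * n              ≡⟨ sym (m≡m%n+[m/n]*n b n) ⟩
    b                              ∎

Least : (ℕ → Set) → Set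
Least P = Σ ℕ λ d → P d × ∀ {j} → P j → d ≤ j

least : {P : ℕ → Set} → Decidable P → ∀ i → P i → Least P
least P? zero    p = 0 , p , λ _ → z≤n
least P? (suc i) p with P? 0
... | yes p₀ = 0 , p₀ , λ _ → z≤n
... | no ¬p₀ with least (λ j → P? (suc j)) i p
...   | d , p-d , d-min = suc d , p-d , below
  where
  below : ∀ {j} → _ → suc d ≤ j
  below {zero}  p₀ = contradiction p₀ ¬p₀
  below {suc j} pⱼ = s≤s (d-min pⱼ)

module _ {Q : ℕ → Set} (Q? : Decidable Q) where

  crossing : ℕ → ℕ
  crossing zero = zero
  crossing (suc k) with Q? k
  ... | yes _ = crossing k
  ... | no _  = k

  crossing-spec : ∀ k → ¬ Q 0 → Q k →
                  crossing k < k × ¬ Q (crossing k) × Q (suc (crossing k))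
  crossing-spec zero    ¬q₀ qₖ = contradiction qₖ ¬q₀
  crossing-spec (suc k) ¬q₀ q₁₊ₖ with Q? k
  ... | yes qₖ with crossing-spec k ¬q₀ qₖ
  ...   | j<k , ¬qⱼ , q₁₊ⱼ = m<n⇒m<1+n j<k , ¬qⱼ , q₁₊ⱼ
  crossing-spec (suc k) ¬q₀ q₁₊ₖ | no ¬qₖ = n<1+n k , ¬qₖ , q₁₊ₖ

module _ {n : ℕ} (T : Tournament n) where
  open Tournament T

  arc? : ∀ x y → Dec (arc x y)
  arc? x y with x ≟ y
  ... | yes refl = no (irrefl x)
  ... | no x≢y with total x y x≢y
  ...   | inj₁ xy = yes xy
  ...   | inj₂ yx = no (λ xy → asym x y xy yx)

  reverse-arc : ∀ {x y} → x ≢ y → ¬ arc x y → arc y x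
  reverse-arc {x} {y} x≢y ¬xy with total x y x≢y
  ... | inj₁ xy = contradiction xy ¬xy
  ... | inj₂ yx = yx

  Walk-map : ∀ {S S′ x y} → S ⊆ S′ → Walk T S x y → Walk T S′ x y
  Walk-map S⊆S′ (step sx sy xy) = step (S⊆S′ sx) (S⊆S′ sy) xy
  Walk-map S⊆S′ (cons sx xy w)  = cons (S⊆S′ sx) xy (Walk-map S⊆S′ w)

  Walk-head : ∀ {S x y} → Walk T S x y → S x
  Walk-head (step sx _ _) = sx
  Walk-head (cons sx _ _) = sx

  Walk-last : ∀ {S x y} → Walk T S x y → ∃ λ z → S z × arc z y
  Walk-last (step sx _ xy) = _ , sx , xy
  Walk-last (cons _ _ w)   = Walk-last w

  Acyclic-⊆ : ∀ {S S′} → S ⊆ S′ → Acyclic T S′ → Acyclic T S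
  Acyclic-⊆ S⊆S′ acyclic x w = acyclic x (Walk-map S⊆S′ w)

  DichrLe-⊆ : ∀ {S S′ k} → S ⊆ S′ → DichrLe T S′ k → DichrLe T S k
  DichrLe-⊆ S⊆S′ (c , acyclic) =
    c , λ i → Acyclic-⊆ (λ (s , cᵢ) → S⊆S′ s , cᵢ) (acyclic i)

  module _ {S : Pred (Fin n) 0ℓ} {f : Fin n → ℕ}
           (descends : ∀ {a b} → S a → S b → arc a b → f b ≤ f a) where

    Walk-descends : ∀ {x y} → Walk T S x y → f y ≤ f x
    Walk-descends (step sx sy xy) = descends sx sy xy
    Walk-descends (cons sx xy w)  = ≤-trans (Walk-descends w) (descends sx (Walk-head w) xy)

    Walk-between : ∀ {x y} → Walk T S x y → Walk T (λ w → S w × f y ≤ f w × f w ≤ f x) x y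
    Walk-between (step sx sy xy) = step (sx , descends sx sy xy , ≤-refl) (sy , ≤-refl , descends sx sy xy) xy
    Walk-between w@(cons sx xy w′) =
      cons (sx , Walk-descends w , ≤-refl) xy
           (Walk-map (λ (s , lo , hi) → s , lo , ≤-trans hi (descends sx (Walk-head w′) xy)) (Walk-between w′))

    Acyclic-byLevels : (∀ ℓ → Acyclic T (S ∩ λ w → f w ≡ ℓ)) → Acyclic T S
    Acyclic-byLevels acyclic x w =
      acyclic (f x) x (Walk-map (λ (s , lo , hi) → s , ≤-antisym hi lo) (Walk-between w))

  DichrLe-byColouring : ∀ {S : Pred (Fin n) 0ℓ} {C : Set} {k} (colour : Fin n → C) (enc : C → Fin k) →
                        Injective _≡_ _≡_ enc → (∀ κ → Acyclic T (S ∩ λ x → colour x ≡ κ)) →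
                        DichrLe T S k
  DichrLe-byColouring colour enc enc-injective acyclic = (λ x → enc (colour x)) , λ i x w →
    acyclic (colour x) x
      (Walk-map (λ (s , eᵢ) → s , enc-injective (trans eᵢ (sym (proj₂ (Walk-head w))))) w)

  DichrLe-split : ∀ {S P : Pred (Fin n) 0ℓ} {a b} → Decidable P →
                  DichrLe T (S ∩ P) a → DichrLe T (S ∩ ∁ P) b → DichrLe T S (a + b)
  DichrLe-split {S} {P} {a} {b} P? (cP , acyclicP) (c∁P , acyclic∁P) =
    DichrLe-byColouring side (join a b) join-injective acyclic
    where
    side : Fin n → Fin a ⊎ Fin b
    side x with P? x
    ... | yes _ = inj₁ (cP x)
    ... | no _  = inj₂ (c∁P x)

    join-injective : Injective _≡_ _≡_ (join a b)
    join-injective {i} {j} eq =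
      trans (sym (splitAt-join a b i)) (trans (cong (splitAt a) eq) (splitAt-join a b j))

    side-inj₁ : ∀ {x i} → side x ≡ inj₁ i → P x × cP x ≡ i
    side-inj₁ {x} eq with P? x
    side-inj₁ refl | yes px = px , refl

    side-inj₂ : ∀ {x i} → side x ≡ inj₂ i → ¬ P x × c∁P x ≡ i
    side-inj₂ {x} eq with P? x
    side-inj₂ refl | no ¬px = ¬px , refl

    acyclic : ∀ κ → Acyclic T (S ∩ λ x → side x ≡ κ)
    acyclic (inj₁ i) = Acyclic-⊆ (λ (s , eq) → (s , proj₁ (side-inj₁ eq)) , proj₂ (side-inj₁ eq)) (acyclicP i)
    acyclic (inj₂ i) = Acyclic-⊆ (λ (s , eq) → (s , proj₁ (side-inj₂ eq)) , proj₂ (side-inj₂ eq)) (acyclic∁P i)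

  Walk-avoid : ∀ {S x y} v → (∀ {w} → S w → ¬ arc w v) → x ≢ v →
               Walk T S x y → Walk T (S ∩ λ w → w ≢ v) x y
  Walk-avoid v noArc x≢v (step sx sy xy) = step (sx , x≢v) (sy , λ { refl → noArc sx xy }) xy
  Walk-avoid v noArc x≢v (cons sx xy w)  = cons (sx , x≢v) xy (Walk-avoid v noArc (λ { refl → noArc sx xy }) w)

  DichrLe-addSource : ∀ {S k} v → (∀ {w} → S w → ¬ arc w v) →
                      DichrLe T (S ∩ λ w → w ≢ v) k → DichrLe T S k
  DichrLe-addSource v noArc (c , acyclic) = c , λ i x w →
    let (z , (sz , _) , zx) = Walk-last w in
    acyclic i x (Walk-map (λ ((s , cᵢ) , w≢v) → (s , w≢v) , cᵢ)
                          (Walk-avoid v (λ (s , _) → noArc s) (λ { refl → noArc sz zx }) w))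

  record Geodesic (d : Fin n → ℕ) (u v : Fin n) (k : ℕ) : Set where
    field
      vertex       : ℕ → Fin n
      vertex-start : vertex 0 ≡ u
      vertex-end   : vertex k ≡ v
      vertex-level : ∀ {i} → i ≤ k → d (vertex i) ≡ i
      vertex-arc   : ∀ {i} → i < k → arc (vertex i) (vertex (suc i))

module Distance {n : ℕ} (T : Tournament n) (strong : StronglyConnected T) (u : Fin n) where
  open Tournament T

  Reach : ℕ → Pred (Fin n) 0ℓ
  Reach zero    x = u ≡ x
  Reach (suc i) x = Reach i x ⊎ ∃ λ y → Reach i y × arc y x

  reach? : ∀ i → Decidable (Reach i)
  reach? zero    x = u ≟ x
  reach? (suc i) x = reach? i x ⊎-dec any? (λ y → reach? i y ×-dec arc? T y x)

  Walk-reach : ∀ {i x y} → Reach i x → Walk T (Whole T) x y → ∃ λ j → Reach j y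
  Walk-reach r (step _ _ xy) = _ , inj₂ (_ , r , xy)
  Walk-reach r (cons _ xy w) = Walk-reach (inj₂ (_ , r , xy)) w

  reachable : ∀ x → ∃ λ i → Reach i x
  reachable x with u ≟ x
  ... | yes u≡x = 0 , u≡x
  ... | no u≢x  = Walk-reach refl (strong u x u≢x)

  shortest : ∀ x → Least λ i → Reach i x
  shortest x = uncurry (least (λ i → reach? i x)) (reachable x)

  dist : Fin n → ℕ
  dist x = proj₁ (shortest x)

  dist-reach : ∀ x → Reach (dist x) x
  dist-reach x = proj₁ (proj₂ (shortest x))

  dist-min : ∀ {i x} → Reach i x → dist x ≤ i
  dist-min {x = x} = proj₂ (proj₂ (shortest x))

  dist-arc : ∀ {x y} → arc x y → dist y ≤ suc (dist x)
  dist-arc {x} xy = dist-min (inj₂ (x , dist-reach x , xy))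

  dist≡0 : ∀ {x} → dist x ≡ 0 → u ≡ x
  dist≡0 {x} eq = subst (λ i → Reach i x) eq (dist-reach x)

  predecessor-of : ∀ {x i} → dist x ≡ suc i → ∃ λ y → dist y ≡ i × arc y x
  predecessor-of {x} {i} eq with subst (λ j → Reach j x) eq (dist-reach x)
  ... | inj₁ r = contradiction (subst (_≤ i) eq (dist-min r)) (<⇒≱ ≤-refl)
  ... | inj₂ (y , r , yx) = y , ≤-antisym (dist-min r) (s≤s⁻¹ (subst (_≤ suc (dist y)) eq (dist-arc yx))) , yx

  predecessor : ∀ x → ∃ λ y → dist y ≡ pred (dist x) × (0 < dist x → arc y x)
  predecessor x with dist x in eq
  ... | zero  = x , eq , λ ()
  ... | suc i = let (y , dy , yx) = predecessor-of eq in y , dy , λ _ → yx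

  geodesic : ∀ v → Geodesic T dist u v (dist v)
  geodesic v = record
    { vertex       = vertex
    ; vertex-start = sym (dist≡0 (trans (back-dist k) (n∸n≡0 k)))
    ; vertex-end   = cong back (n∸n≡0 k)
    ; vertex-level = vertex-level
    ; vertex-arc   = vertex-arc
    }
    where
    k : ℕ
    k = dist v

    back : ℕ → Fin n
    back zero    = v
    back (suc j) = proj₁ (predecessor (back j))

    back-dist : ∀ j → dist (back j) ≡ k ∸ j
    back-dist zero    = refl
    back-dist (suc j) = begin
      dist (back (suc j))  ≡⟨ proj₁ (proj₂ (predecessor (back j))) ⟩
      pred (dist (back j)) ≡⟨ cong pred (back-dist j) ⟩
      pred (k ∸ j)         ≡⟨ pred[m∸n]≡m∸[1+n] k j ⟩
      k ∸ suc j            ∎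
      where open ≡-Reasoning

    vertex : ℕ → Fin n
    vertex i = back (k ∸ i)

    vertex-level : ∀ {i} → i ≤ k → dist (vertex i) ≡ i
    vertex-level {i} i≤k = trans (back-dist (k ∸ i)) (m∸[m∸n]≡n i≤k)

    vertex-arc : ∀ {i} → i < k → arc (vertex i) (vertex (suc i))
    vertex-arc {i} i<k = subst (λ j → arc (back j) (vertex (suc i))) (sym (+-∸-assoc 1 i<k))
      (proj₂ (proj₂ (predecessor (vertex (suc i)))) (subst (0 <_) (sym (vertex-level i<k)) z<s))

module GeodesicColouring
  {n : ℕ} (T : Tournament n) {t : ℕ} (bounded : ArcBounded T t) (1≤t : 1 ≤ t)
  {d : Fin n → ℕ} (d-arc : ∀ {x y} → Tournament.arc T x y → d y ≤ suc (d x))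
  {u v : Fin n} {k : ℕ} (γ : Geodesic T d u v k) where
  open Tournament T
  open Geodesic γ renaming (vertex to p)

  Band : Pred (Fin n) 0ℓ
  Band w = ¬ arc u w × arc v w

  key : Fin n → ℕ
  key w = crossing (λ i → arc? T (p i) w) k

  key-spec : ∀ {w} → Band w → key w < k × Narc T (p (key w)) (p (suc (key w))) w
  key-spec {w} (¬uw , vw)
    with crossing-spec (λ i → arc? T (p i) w) k
           (subst (λ x → ¬ arc x w) (sym vertex-start) ¬uw) (subst (λ x → arc x w) (sym vertex-end) vw)
  ... | j<k , ¬pⱼw , p₁₊ⱼw = j<k , p₁₊ⱼw , reverse-arc T pⱼ≢w ¬pⱼw
    where
    pⱼ≢w : p (key w) ≢ w
    pⱼ≢w pⱼ≡w = asym _ _ (vertex-arc j<k) (subst (arc _) (sym pⱼ≡w) p₁₊ⱼw)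

  key-arc : ∀ {a b} → Band a → Band b → arc a b → key b ≤ 4 + key a
  key-arc {a} {b} band-a band-b ab = begin
    key b                    ≡⟨ sym (vertex-level (<⇒≤ kb<k)) ⟩
    d (p (key b))            ≤⟨ d-arc b→p ⟩
    suc (d b)                ≤⟨ s≤s (d-arc ab) ⟩
    2 + d a                  ≤⟨ s≤s (s≤s (d-arc p→a)) ⟩
    3 + d (p (suc (key a)))  ≡⟨ cong (3 +_) (vertex-level ka<k) ⟩
    4 + key a                ∎
    where
    open ≤-Reasoning
    kb<k = proj₁ (key-spec band-b)
    b→p = proj₂ (proj₂ (key-spec band-b))
    ka<k = proj₁ (key-spec band-a)
    p→a = proj₁ (proj₂ (key-spec band-a))

  arcColour : ℕ → Fin n → Fin t
  arcColour j with j <? k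
  ... | yes j<k = proj₁ (bounded _ _ (vertex-arc j<k))
  ... | no _    = λ _ → fromℕ< 1≤t  -- junk: keys of band vertices are < k; the only use of 1 ≤ t

  arcColour-acyclic : ∀ {j} → j < k → ∀ c →
                      Acyclic T (Narc T (p j) (p (suc j)) ∩ λ w → arcColour j w ≡ c)
  arcColour-acyclic {j} j<k c with j <? k
  ... | yes j<k′ = proj₂ (bounded _ _ (vertex-arc j<k′)) c
  ... | no j≮k   = contradiction j<k j≮k

  colour : Fin n → Fin 5 × Fin t
  colour w = key w mod 5 , arcColour (key w) w

  Class : Fin 5 × Fin t → Pred (Fin n) 0ℓ
  Class κ = Band ∩ λ w → colour w ≡ κ

  key-residue : ∀ {a b κ} → Class κ a → Class κ b → key b % 5 ≡ key a % 5
  key-residue {a} {b} (_ , refl) (_ , eq) = begin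
    key b % 5              ≡⟨ sym (toℕ-fromℕ< _) ⟩
    toℕ (key b mod 5)      ≡⟨ cong (toℕ ∘ proj₁) eq ⟩
    toℕ (key a mod 5)      ≡⟨ toℕ-fromℕ< _ ⟩
    key a % 5              ∎
    where open ≡-Reasoning

  level⊆arcClass : ∀ {r c j} → Class (r , c) ∩ (λ w → key w ≡ j) ⊆
                   Narc T (p j) (p (suc j)) ∩ λ w → arcColour j w ≡ c
  level⊆arcClass ((band , refl) , refl) = proj₂ (key-spec band) , refl

  Class-acyclic : ∀ κ → Acyclic T (Class κ)
  Class-acyclic (r , c) = Acyclic-byLevels T descends level-acyclic
    where
    descends : ∀ {a b} → Class (r , c) a → Class (r , c) b → arc a b → key b ≤ key a
    descends ca@(band-a , _) cb@(band-b , _) ab =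
      %-window 5 (key-residue ca cb) (s≤s (key-arc band-a band-b ab))

    level-acyclic : ∀ j → Acyclic T (Class (r , c) ∩ λ w → key w ≡ j)
    level-acyclic j x walk with Walk-head T walk
    ... | (band , _) , refl = arcColour-acyclic (proj₁ (key-spec band)) c x (Walk-map T level⊆arcClass walk)

  Band-dichromatic : DichrLe T Band (5 * t)
  Band-dichromatic = DichrLe-byColouring T colour (uncurry combine) combine-injective′ Class-acyclic
    where
    combine-injective′ : Injective _≡_ _≡_ (uncurry (combine {5} {t}))
    combine-injective′ {r , c} {r′ , c′} eq =
      let (r≡r′ , c≡c′) = combine-injective r c r′ c′ eq in cong₂ _,_ r≡r′ c≡c′

lemma2p5 : (t m n : ℕ) → 1 ≤ t → (T : Tournament n) →
    StronglyConnected T → ArcBounded T t →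
    (u v : Fin n) → DichrLe T (N⁺ T u) m → DichrLe T (N⁻ T v) m →
    DichrLe T (Whole T) (2 * m + 5 * t)
lemma2p5 t m n 1≤t T strong bounded u v χ⁺ χ⁻ =
  subst (DichrLe T (Whole T)) (sym 2m+5t≡m+[m+5t])
    (DichrLe-split T (arc? T u) (DichrLe-⊆ T proj₂ χ⁺)
      (DichrLe-split T (λ w → arc? T w v) (DichrLe-⊆ T proj₂ χ⁻)
        (DichrLe-addSource T v proj₂ (DichrLe-⊆ T rest⊆Band Band-dichromatic))))
  where
  open Distance T strong u using (dist; dist-arc; geodesic)
  open GeodesicColouring T bounded 1≤t dist-arc (geodesic v) using (Band; Band-dichromatic)

  rest⊆Band : ((Whole T ∩ ∁ (N⁺ T u)) ∩ ∁ (N⁻ T v)) ∩ (λ w → w ≢ v) ⊆ Band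
  rest⊆Band (((_ , ¬uw) , ¬wv) , w≢v) = ¬uw , reverse-arc T w≢v ¬wv

  2m+5t≡m+[m+5t] : 2 * m + 5 * t ≡ m + (m + 5 * t)
  2m+5t≡m+[m+5t] = trans (+-assoc m (m + 0) (5 * t)) (cong (λ x → m + (x + 5 * t)) (+-identityʳ m))
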